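{- Let $G$ and $H$ be finite simple graphs, and let $c$ be a greedy colouring of $G[H]$. Then for every $x\in V(G)$, at most $\Gamma(H)$ distinct colours of $c$ appear on the vertex set $\{x\}\times V(H)$.
   Context: A greedy colouring of a graph is a partition of its vertex set into nonempty stable sets $S_1,\dots,S_m$ (the vertices of $S_i$ receive colour $i$) such that for every $j<i$, every vertex of $S_i$ has a neighbour in $S_j$. The Grundy number $\Gamma$ is the largest $m$ for which such a partition exists. The lexicographic product $G[H]$ has vertex set $V(G)\times V(H)$, and $(a,x)(b,y)$ is an edge iff $ab\in E(G)$, or $a=b$ and $xy\in E(H)$. -}

module Defs where

open import Data.Nat using (ℕ; _≤_)
open import Data.Bool using (Bool; true; false; _∨_; _∧_)
open import Data.Fin using (Fin; _<_; _≟_)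
open import Data.Fin.Subset using (Subset; inside; outside; ∣_∣)
open import Data.Fin.Properties using (any?)
open import Data.Vec using (tabulate)
open import Data.Product using (_×_; _,_; Σ; ∃)
open import Relation.Binary.PropositionalEquality using (_≡_)
open import Relation.Nullary using (¬_)
open import Relation.Nullary.Decidable using (⌊_⌋)

record Graph : Set where
  field
    n      : ℕ
    adj    : Fin n → Fin n → Bool
    sym    : ∀ x y → adj x y ≡ adj y x
    irrefl : ∀ x → adj x x ≡ false

open Graph public

Edge : {V : Set} → (V → V → Bool) → V → V → Set
Edge adj u v = adj u v ≡ true

-- c : V → Fin m is a greedy colouring with m colours: colour classes
-- S_1..S_m (here indexed 0..m-1) are nonempty (c surjective), stable,
-- and every vertex of colour i has a neighbour of colour j for all j < i.
record IsGreedyColouring {V : Set} (adj : V → V → Bool) (m : ℕ) (c : V → Fin m) : Set where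
  field
    nonempty : ∀ (i : Fin m) → ∃ λ v → c v ≡ i
    stable   : ∀ u v → Edge adj u v → ¬ (c u ≡ c v)
    greedy   : ∀ v (j : Fin m) → j < c v → ∃ λ u → Edge adj v u × c u ≡ j

IsGreedyColouringOf : (G : Graph) (m : ℕ) → (Fin (n G) → Fin m) → Set
IsGreedyColouringOf G = IsGreedyColouring (adj G)

IsGrundyNumber : Graph → ℕ → Set
IsGrundyNumber G k =
  (Σ (Fin (n G) → Fin k) λ c → IsGreedyColouringOf G k c) ×
  (∀ m (c : Fin (n G) → Fin m) → IsGreedyColouringOf G m c → m ≤ k)

LexV : Graph → Graph → Set
LexV G H = Fin (n G) × Fin (n H)

lexAdj : (G H : Graph) → LexV G H → LexV G H → Bool
lexAdj G H (a , x) (b , y) = adj G a b ∨ (⌊ a ≟ b ⌋ ∧ adj H x y)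

coloursOnFibre : (G H : Graph) {m : ℕ} → (LexV G H → Fin m) → Fin (n G) → Subset m
coloursOnFibre G H c x =
  tabulate λ i → if⌊ any? (λ y → c (x , y) ≟ i) ⌋
  where
  if⌊_⌋ : {P : Set} → Relation.Nullary.Dec P → Data.Fin.Subset.Side
  if⌊ d ⌋ with ⌊ d ⌋
  ... | true  = inside
  ... | false = outside

-- The colours used on a fibre {x} × V(H) can be renumbered order-preservingly
-- as 0, …, s−1, where s is their number, giving a colouring of H.  It is proper
-- because H-edges lie in G[H].  It is greedy: a vertex (x,y) has, for each
-- colour i below its own, a neighbour (b,w) of colour i; if i also occurs on
-- the fibre, at (x,z) say, then b = x, for otherwise (x,z) and (b,w) would be
-- adjacent through the G-edge xb while sharing a colour.  So (b,w) = (x,w) with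
-- yw ∈ E(H).  Hence s is the number of colours of a greedy colouring of H, and
-- s ≤ Γ(H).
module Submission where

open import Defs hiding (sym)
open import Data.Nat using (ℕ; _≤_)
open import Data.Fin using (Fin)
open import Data.Fin.Subset using (∣_∣)

import Data.Nat as ℕ
import Data.Nat.Properties as ℕ
open import Data.Bool using (Bool; true; false)
open import Data.Empty using (⊥-elim)
open import Data.Fin as Fin using (zero; suc; toℕ; fromℕ<)
import Data.Fin.Properties as Fin
open import Data.Fin.Subset using (Subset; inside; outside; _∈_)
open import Data.Product using (_×_; _,_; ∃)
open import Data.Sum using (_⊎_; inj₁; inj₂)
open import Data.Vec using (_∷_; lookup; here; there)
open import Data.Vec.Properties using (lookup∘tabulate; []=⇒lookup; lookup⇒[]=)
open import Relation.Binary using (tri<; tri≈; tri>)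
open import Relation.Binary.PropositionalEquality
  using (_≡_; _≢_; refl; sym; trans; cong; subst₂)
open import Relation.Nullary using (yes; no)

rank : ∀ {m} → Subset m → Fin m → ℕ
rank (_       ∷ S) zero    = 0
rank (inside  ∷ S) (suc i) = ℕ.suc (rank S i)
rank (outside ∷ S) (suc i) = rank S i

rank<∣S∣ : ∀ {m} {S : Subset m} {i} → i ∈ S → rank S i ℕ.< ∣ S ∣
rank<∣S∣ here                       = ℕ.s≤s ℕ.z≤n
rank<∣S∣ {S = inside  ∷ _} (there p) = ℕ.s≤s (rank<∣S∣ p)
rank<∣S∣ {S = outside ∷ _} (there p) = rank<∣S∣ p

rank-strictMono : ∀ {m} {S : Subset m} {i j} → i ∈ S → i Fin.< j → rank S i ℕ.< rank S j
rank-strictMono {j = suc _} here _ = ℕ.s≤s ℕ.z≤n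
rank-strictMono {S = inside  ∷ _} {j = suc _} (there p) (ℕ.s≤s i<j) = ℕ.s≤s (rank-strictMono p i<j)
rank-strictMono {S = outside ∷ _} {j = suc _} (there p) (ℕ.s≤s i<j) = rank-strictMono p i<j

rank-surjective : ∀ {m} (S : Subset m) {k} → k ℕ.< ∣ S ∣ → ∃ λ i → i ∈ S × rank S i ≡ k
rank-surjective (inside ∷ S) {ℕ.zero} _ = zero , here , refl
rank-surjective (inside ∷ S) {ℕ.suc k} (ℕ.s≤s k<∣S∣) with rank-surjective S k<∣S∣
... | i , i∈S , refl = suc i , there i∈S , refl
rank-surjective (outside ∷ S) k<∣S∣ with rank-surjective S k<∣S∣
... | i , i∈S , refl = suc i , there i∈S , refl

rank-injective : ∀ {m} {S : Subset m} {i j} → i ∈ S → j ∈ S → rank S i ≡ rank S j → i ≡ j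
rank-injective {i = i} {j} i∈S j∈S ri≡rj with Fin.<-cmp i j
... | tri< i<j _ _ = ⊥-elim (ℕ.<-irrefl ri≡rj (rank-strictMono i∈S i<j))
... | tri≈ _ i≡j _ = i≡j
... | tri> _ _ j<i = ⊥-elim (ℕ.<-irrefl (sym ri≡rj) (rank-strictMono j∈S j<i))

rank-cancel-< : ∀ {m} {S : Subset m} {i j} → j ∈ S → rank S i ℕ.< rank S j → i Fin.< j
rank-cancel-< {i = i} {j} j∈S ri<rj with Fin.<-cmp i j
... | tri< i<j _ _  = i<j
... | tri≈ _ refl _ = ⊥-elim (ℕ.<-irrefl refl ri<rj)
... | tri> _ _ j<i  = ⊥-elim (ℕ.<-asym ri<rj (rank-strictMono j∈S j<i))

-- The greedy condition is only needed for colours that c actually uses.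
module Compress {V : Set} (adj : V → V → Bool) {m} (c : V → Fin m) (S : Subset m)
                (c∈S : ∀ v → c v ∈ S) (∈S⇒c : ∀ {i} → i ∈ S → ∃ λ v → c v ≡ i) where

  compress : V → Fin ∣ S ∣
  compress v = fromℕ< (rank<∣S∣ (c∈S v))

  toℕ-compress : ∀ v → toℕ (compress v) ≡ rank S (c v)
  toℕ-compress v = Fin.toℕ-fromℕ< _

  compress-greedy : (∀ u v → Edge adj u v → c u ≢ c v) →
                    (∀ v i → i Fin.< c v → i ∈ S → ∃ λ u → Edge adj v u × c u ≡ i) →
                    IsGreedyColouring adj ∣ S ∣ compress
  compress-greedy stable greedy = record
    { nonempty = nonempty
    ; stable   = λ u v uv cu≡cv → stable u v uv (rank-injective (c∈S u) (c∈S v)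
                   (trans (sym (toℕ-compress u)) (trans (cong toℕ cu≡cv) (toℕ-compress v))))
    ; greedy   = greedy′
    }
    where
    rank⁻¹ : ∀ (j : Fin ∣ S ∣) → ∃ λ i → i ∈ S × rank S i ≡ toℕ j
    rank⁻¹ j = rank-surjective S (Fin.toℕ<n j)

    compress-≡ : ∀ {v i} (j : Fin ∣ S ∣) → c v ≡ i → rank S i ≡ toℕ j → compress v ≡ j
    compress-≡ {v} j refl ri≡j = Fin.toℕ-injective (trans (toℕ-compress v) ri≡j)

    nonempty : ∀ j → ∃ λ v → compress v ≡ j
    nonempty j with rank⁻¹ j
    ... | i , i∈S , ri≡j with ∈S⇒c i∈S
    ...   | v , cv≡i = v , compress-≡ j cv≡i ri≡j

    greedy′ : ∀ v j → j Fin.< compress v → ∃ λ u → Edge adj v u × compress u ≡ j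
    greedy′ v j j<v with rank⁻¹ j
    ... | i , i∈S , ri≡j with greedy v i (rank-cancel-< (c∈S v) ri<rcv) i∈S
      where
      ri<rcv : rank S i ℕ.< rank S (c v)
      ri<rcv = subst₂ ℕ._<_ (sym ri≡j) (toℕ-compress v) j<v
    ...   | u , vu , cu≡i = u , vu , compress-≡ j cu≡i ri≡j

module _ (G H : Graph) where

  lexAdj-base : ∀ {a b} {y w} → Edge (adj G) a b → Edge (lexAdj G H) (a , y) (b , w)
  lexAdj-base ab rewrite ab = refl

  lexAdj-fibre : ∀ {x} {y w} → Edge (adj H) y w → Edge (lexAdj G H) (x , y) (x , w)
  lexAdj-fibre {x} yw rewrite irrefl G x | yw with x Fin.≟ x
  ... | yes _  = refl
  ... | no x≢x = ⊥-elim (x≢x refl)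

  lexAdj-inv : ∀ {a b} {y w} → Edge (lexAdj G H) (a , y) (b , w) →
               Edge (adj G) a b ⊎ (a ≡ b × Edge (adj H) y w)
  lexAdj-inv {a} {b} e with adj G a b
  ... | true  = inj₁ refl
  ... | false with a Fin.≟ b
  ...   | yes refl = inj₂ (refl , e)
  ...   | no  _    with e
  ...     | ()

  module _ {m} (c : LexV G H → Fin m) (x : Fin (n G)) where

    private
      S = coloursOnFibre G H c x

    coloursOnFibre⁺ : ∀ y → c (x , y) ∈ S
    coloursOnFibre⁺ y = lookup⇒[]= _ S lookup-c
      where
      lookup-c : lookup S (c (x , y)) ≡ inside
      lookup-c with lookup S (c (x , y)) in eq
      ... | true  = refl
      ... | false with Fin.any? (λ z → c (x , z) Fin.≟ c (x , y))
                     | trans (sym (lookup∘tabulate _ (c (x , y)))) eq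
      ...   | no ¬∃ | _ = ⊥-elim (¬∃ (y , refl))

    coloursOnFibre⁻ : ∀ {i} → i ∈ S → ∃ λ y → c (x , y) ≡ i
    coloursOnFibre⁻ {i} i∈S with Fin.any? (λ y → c (x , y) Fin.≟ i)
                               | trans (sym (lookup∘tabulate _ i)) ([]=⇒lookup i∈S)
    ... | yes ∃y | _ = ∃y

    neighbour-in-fibre : IsGreedyColouring (lexAdj G H) m c →
                         ∀ {y b w} → Edge (lexAdj G H) (x , y) (b , w) → c (b , w) ∈ S →
                         b ≡ x × Edge (adj H) y w
    neighbour-in-fibre gc e cbw∈S with lexAdj-inv e | coloursOnFibre⁻ cbw∈S
    ... | inj₁ xb          | _ , czw = ⊥-elim (IsGreedyColouring.stable gc _ _ (lexAdj-base xb) czw)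
    ... | inj₂ (refl , yw) | _       = refl , yw

    fibre-greedy : IsGreedyColouring (lexAdj G H) m c →
                   IsGreedyColouringOf H ∣ S ∣ (Compress.compress (adj H) (λ y → c (x , y)) S
                                                  coloursOnFibre⁺ coloursOnFibre⁻)
    fibre-greedy gc = Compress.compress-greedy (adj H) _ S coloursOnFibre⁺ coloursOnFibre⁻
      (λ y w yw → IsGreedyColouring.stable gc _ _ (lexAdj-fibre yw))
      greedy
      where
      greedy : ∀ y i → i Fin.< c (x , y) → i ∈ S → ∃ λ w → Edge (adj H) y w × c (x , w) ≡ i
      greedy y i i<c i∈S with IsGreedyColouring.greedy gc (x , y) i i<c
      ... | (b , w) , e , refl with neighbour-in-fibre gc e i∈S
      ...   | refl , yw = w , yw , refl

proposition10 : (G H : Graph) (m : ℕ) (c : LexV G H → Fin m) →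
                IsGreedyColouring (lexAdj G H) m c →
                (k : ℕ) → IsGrundyNumber H k →
                (x : Fin (n G)) → ∣ coloursOnFibre G H c x ∣ ≤ k
proposition10 G H m c gc k (_ , maximal) x = maximal _ _ (fibre-greedy G H c x gc)
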